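{- For all integers $k\ge 2$ and $n\ge 1$, the number of inversions of the permutation $\sigma_{k,n}$ is $\frac{(k-1)k}{2}\cdot\frac{n(n+1)}{2}$. In particular, for each $k\ge2$, the sequence $(\operatorname{sign}(\sigma_{k,n}))_{n\ge1}$ is periodic: if $k\equiv 2$ or $3 \pmod 4$ it is periodic with repeating block $(-1,-1,1,1)$ (starting at $n=1$), and if $k\equiv 0$ or $1\pmod 4$ it is constantly equal to $1$.
   Context: For integers $k\ge 2$, $n\ge 1$, $\sigma_{k,n}$ is the permutation of $\{1,\dots,kn\}$ given by $x\mapsto kx \bmod (kn+1)$ (residue taken in $\{1,\dots,kn\}$). An inversion of a permutation $\sigma$ is a pair $\{i,j\}$ with $i<j$ and $\sigma(i)>\sigma(j)$; $\operatorname{sign}(\sigma)$ is $1$ if the number of inversions is even and $-1$ otherwise. -}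

module Defs where

open import Data.Nat using (ℕ; zero; suc; _+_; _*_; _∸_; _<ᵇ_; _≡ᵇ_)
open import Data.Nat.DivMod using (_%_)
open import Data.Bool using (Bool; true; false; if_then_else_)
open import Data.List using (List; []; _∷_; length; filter; concatMap; upTo; map)
open import Data.Integer using (ℤ; +_; -_)
open import Relation.Nullary.Decidable using (T?)
open import Data.Bool using (T)

-- σ_{k,n}(x) = k x mod (k n + 1), for x ∈ {1,…,kn}.
-- For such x the residue is never 0 (gcd(k, kn+1) = 1), so it lies in {1,…,kn}.
σ : ℕ → ℕ → ℕ → ℕ
σ k n x = (k * x) % suc (k * n)

range1 : ℕ → List ℕ
range1 m = map suc (upTo m)

record Pair : Set where
  constructor _,,_
  field fst snd : ℕ

pairsLt : ℕ → List Pair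
pairsLt m = concatMap (λ j → map (λ i → i ,, j) (filter (λ i → T? (i <ᵇ j)) (range1 m))) (range1 m)

inversions : ℕ → (ℕ → ℕ) → ℕ
inversions m f = length (filter (λ p → T? (isInv p)) (pairsLt m))
  where
    isInv : Pair → Bool
    isInv (i ,, j) = f j <ᵇ f i

invσ : ℕ → ℕ → ℕ
invσ k n = inversions (k * n) (σ k n)

signOf : ℕ → ℤ
signOf m = if ((m % 2) ≡ᵇ 0) then + 1 else - (+ 1)

signσ : ℕ → ℕ → ℤ
signσ k n = signOf (invσ k n)

-- Write the positions as x = a n + t + 1 with block a < k and offset t < n.  Then
-- σ(x) = k t + (k - a): on each block σ increases with step k, and the blocks are
-- interleaved in reverse order.  Hence x < y is an inversion exactly when x lies in
-- an earlier block than y at a weakly larger offset, and counting these pairs gives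
-- (0 + 1 + ⋯ + (k-1)) · (1 + 2 + ⋯ + n).  The parity of a triangular number
-- 0 + 1 + ⋯ + (m-1) depends only on m mod 4, which yields the signs.
module Submission where

open import Defs
open import Data.Nat using (ℕ; suc; _+_; _*_; _∸_; _≤_; _/_; _%_)
open import Data.Integer using (ℤ; +_; -_)
open import Data.Product using (_×_)
open import Data.Sum using (_⊎_)
open import Relation.Binary.PropositionalEquality using (_≡_)

open import Data.Nat using (zero; _<_; _≮_; _<ᵇ_; _≡ᵇ_; s≤s; z<s; s<s)
open import Data.Nat.Properties
open import Algebra.Properties.CommutativeSemigroup +-commutativeSemigroup
  using () renaming (interchange to +-interchange)
open import Data.Nat.DivMod using ([m+kn]%n≡m%n; m<n⇒m%n≡m; m*n/n≡m)
open import Data.Nat.Tactic.RingSolver using (solve-∀)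
open import Data.Bool using (Bool; true; false; _∧_; _∨_; not; if_then_else_; T)
open import Data.Bool.Properties using (T-≡)
open import Data.List using (List; []; _∷_; _++_; length; filter; map; concatMap; applyUpTo)
open import Data.List.Properties using (map-upTo)
open import Data.Product using (_,_)
open import Data.Sum using (inj₁; inj₂)
open import Function using (_∘_; Equivalence)
open import Relation.Nullary using (contradiction)
open import Relation.Nullary.Decidable using (T?)
open import Relation.Binary.PropositionalEquality
  using (refl; sym; trans; cong; cong₂; subst; module ≡-Reasoning)
open import Relation.Binary.Definitions using (tri<; tri≈; tri>)

∑< : ℕ → (ℕ → ℕ) → ℕ
∑< zero    f = 0
∑< (suc n) f = f 0 + ∑< n (f ∘ suc)

syntax ∑< n (λ i → e) = ∑[ i < n ] e

∑-cong : ∀ n {f g : ℕ → ℕ} → (∀ i → i < n → f i ≡ g i) → ∑< n f ≡ ∑< n g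
∑-cong zero    eq = refl
∑-cong (suc n) eq = cong₂ _+_ (eq 0 z<s) (∑-cong n (λ i i<n → eq (suc i) (s<s i<n)))

∑-const : ∀ n c → ∑[ i < n ] c ≡ n * c
∑-const zero    c = refl
∑-const (suc n) c = cong (_+_ c) (∑-const n c)

∑-distrib-+ : ∀ n (f g : ℕ → ℕ) → ∑[ i < n ] (f i + g i) ≡ ∑< n f + ∑< n g
∑-distrib-+ zero    f g = refl
∑-distrib-+ (suc n) f g =
  trans (cong (_+_ (f 0 + g 0)) (∑-distrib-+ n (f ∘ suc) (g ∘ suc))) (+-interchange (f 0) (g 0) _ _)

∑-*ˡ : ∀ n c (f : ℕ → ℕ) → ∑[ i < n ] (c * f i) ≡ c * ∑< n f
∑-*ˡ zero    c f = sym (*-zeroʳ c)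
∑-*ˡ (suc n) c f = trans (cong (_+_ (c * f 0)) (∑-*ˡ n c (f ∘ suc))) (sym (*-distribˡ-+ c (f 0) _))

∑-*ʳ : ∀ n c (f : ℕ → ℕ) → ∑[ i < n ] (f i * c) ≡ ∑< n f * c
∑-*ʳ zero    c f = refl
∑-*ʳ (suc n) c f = trans (cong (_+_ (f 0 * c)) (∑-*ʳ n c (f ∘ suc))) (sym (*-distribʳ-+ c (f 0) _))

∑-product : ∀ m n (f g : ℕ → ℕ) → ∑[ a < m ] ∑[ t < n ] (f a * g t) ≡ ∑< m f * ∑< n g
∑-product m n f g = begin
  ∑[ a < m ] ∑[ t < n ] (f a * g t) ≡⟨ ∑-cong m (λ a _ → ∑-*ˡ n (f a) g) ⟩
  ∑[ a < m ] (f a * ∑< n g)         ≡⟨ ∑-*ʳ m (∑< n g) f ⟩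
  ∑< m f * ∑< n g                   ∎
  where open ≡-Reasoning

∑-+ : ∀ m n (f : ℕ → ℕ) → ∑< (m + n) f ≡ ∑< m f + ∑[ i < n ] f (m + i)
∑-+ zero    n f = refl
∑-+ (suc m) n f = trans (cong (_+_ (f 0)) (∑-+ m n (f ∘ suc))) (sym (+-assoc (f 0) _ _))

∑-blocks : ∀ m n (f : ℕ → ℕ) → ∑< (m * n) f ≡ ∑[ a < m ] ∑[ t < n ] f (a * n + t)
∑-blocks zero    n f = refl
∑-blocks (suc m) n f = begin
  ∑< (n + m * n) f                                   ≡⟨ ∑-+ n (m * n) f ⟩
  ∑< n f + ∑[ i < m * n ] f (n + i)                  ≡⟨ cong (_+_ (∑< n f)) (∑-blocks m n (λ i → f (n + i))) ⟩
  ∑< n f + ∑[ a < m ] ∑[ t < n ] f (n + (a * n + t)) ≡⟨ cong (_+_ (∑< n f)) (∑-cong m (λ a _ →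
                                                          ∑-cong n (λ t _ → cong f (sym (+-assoc n (a * n) t))))) ⟩
  ∑< n f + ∑[ a < m ] ∑[ t < n ] f (n + a * n + t)   ∎
  where open ≡-Reasoning

indicator : Bool → ℕ
indicator true  = 1
indicator false = 0

indicator-∧ : ∀ x y → indicator (x ∧ y) ≡ indicator x * indicator y
indicator-∧ true  y = sym (+-identityʳ (indicator y))
indicator-∧ false y = refl

∑-indicator-< : ∀ m b → b ≤ m → ∑[ a < m ] indicator (a <ᵇ b) ≡ b
∑-indicator-< m       zero    _         = trans (∑-const m 0) (*-zeroʳ m)
∑-indicator-< (suc m) (suc b) (s≤s b≤m) = cong suc (∑-indicator-< m b b≤m)

∑-indicator-≥ : ∀ n u → ∑[ t < n ] indicator (not (t <ᵇ u)) ≡ n ∸ u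
∑-indicator-≥ zero    u       = sym (0∸n≡0 u)
∑-indicator-≥ (suc n) zero    = cong suc (trans (∑-const n 1) (*-identityʳ n))
∑-indicator-≥ (suc n) (suc u) = ∑-indicator-≥ n u

module _ {A : Set} where

  count : (A → Bool) → List A → ℕ
  count p []       = 0
  count p (x ∷ xs) = indicator (p x) + count p xs

  length-filter : ∀ (p : A → Bool) xs → length (filter (T? ∘ p) xs) ≡ count p xs
  length-filter p []       = refl
  length-filter p (x ∷ xs) with p x
  ... | true  = cong suc (length-filter p xs)
  ... | false = length-filter p xs

  count-filter : ∀ (p q : A → Bool) xs → count p (filter (T? ∘ q) xs) ≡ count (λ x → q x ∧ p x) xs
  count-filter p q []       = refl
  count-filter p q (x ∷ xs) with q x
  ... | true  = cong (_+_ (indicator (p x))) (count-filter p q xs)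
  ... | false = count-filter p q xs

  count-++ : ∀ (p : A → Bool) xs ys → count p (xs ++ ys) ≡ count p xs + count p ys
  count-++ p []       ys = refl
  count-++ p (x ∷ xs) ys = trans (cong (_+_ (indicator (p x))) (count-++ p xs ys)) (sym (+-assoc (indicator (p x)) _ _))

  count-applyUpTo : ∀ (p : A → Bool) f m → count p (applyUpTo f m) ≡ ∑[ i < m ] indicator (p (f i))
  count-applyUpTo p f zero    = refl
  count-applyUpTo p f (suc m) = cong (_+_ (indicator (p (f 0)))) (count-applyUpTo p (f ∘ suc) m)

module _ {A B : Set} where

  count-map : ∀ (p : B → Bool) (h : A → B) xs → count p (map h xs) ≡ count (p ∘ h) xs
  count-map p h []       = refl
  count-map p h (x ∷ xs) = cong (_+_ (indicator (p (h x)))) (count-map p h xs)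

  count-concatMap-applyUpTo : ∀ (p : B → Bool) (g : A → List B) f m →
    count p (concatMap g (applyUpTo f m)) ≡ ∑[ j < m ] count p (g (f j))
  count-concatMap-applyUpTo p g f zero    = refl
  count-concatMap-applyUpTo p g f (suc m) =
    trans (count-++ p (g (f 0)) _) (cong (_+_ (count p (g (f 0)))) (count-concatMap-applyUpTo p g (f ∘ suc) m))

inversions≡∑ : ∀ m f → inversions m f ≡ ∑[ j < m ] ∑[ i < m ] indicator ((i <ᵇ j) ∧ (f (suc j) <ᵇ f (suc i)))
inversions≡∑ m f = begin
  length (filter (T? ∘ isInversion) (concatMap pairsEndingAt (range1 m)))
    ≡⟨ length-filter isInversion (concatMap pairsEndingAt (range1 m)) ⟩
  count isInversion (concatMap pairsEndingAt (range1 m))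
    ≡⟨ cong (λ xs → count isInversion (concatMap pairsEndingAt xs)) (map-upTo suc m) ⟩
  count isInversion (concatMap pairsEndingAt (applyUpTo suc m))
    ≡⟨ count-concatMap-applyUpTo isInversion pairsEndingAt suc m ⟩
  ∑[ j < m ] count isInversion (pairsEndingAt (suc j))
    ≡⟨ ∑-cong m (λ j _ → countPairsEndingAt (suc j)) ⟩
  ∑[ j < m ] ∑[ i < m ] indicator ((i <ᵇ j) ∧ (f (suc j) <ᵇ f (suc i))) ∎
  where
    open ≡-Reasoning
    isInversion : Pair → Bool
    isInversion (i ,, j) = f j <ᵇ f i

    pairsEndingAt : ℕ → List Pair
    pairsEndingAt j = map (_,, j) (filter (λ i → T? (i <ᵇ j)) (range1 m))

    countPairsEndingAt : ∀ j →
      count isInversion (pairsEndingAt j) ≡ ∑[ i < m ] indicator ((suc i <ᵇ j) ∧ (f j <ᵇ f (suc i)))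
    countPairsEndingAt j = begin
      count isInversion (pairsEndingAt j)
        ≡⟨ count-map isInversion (_,, j) (filter (λ i → T? (i <ᵇ j)) (range1 m)) ⟩
      count (λ i → f j <ᵇ f i) (filter (λ i → T? (i <ᵇ j)) (range1 m))
        ≡⟨ count-filter (λ i → f j <ᵇ f i) (_<ᵇ j) (range1 m) ⟩
      count (λ i → (i <ᵇ j) ∧ (f j <ᵇ f i)) (range1 m)
        ≡⟨ cong (count (λ i → (i <ᵇ j) ∧ (f j <ᵇ f i))) (map-upTo suc m) ⟩
      count (λ i → (i <ᵇ j) ∧ (f j <ᵇ f i)) (applyUpTo suc m)
        ≡⟨ count-applyUpTo _ suc m ⟩
      ∑[ i < m ] indicator ((suc i <ᵇ j) ∧ (f j <ᵇ f (suc i))) ∎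

m*t+c≤m*n : ∀ m {c t n} → c ≤ m → t < n → m * t + c ≤ m * n
m*t+c≤m*n m {c} {t} {n} c≤m t<n = begin
  m * t + c ≤⟨ +-monoʳ-≤ (m * t) c≤m ⟩
  m * t + m ≡⟨ trans (+-comm (m * t) m) (sym (*-suc m t)) ⟩
  m * suc t ≤⟨ *-monoʳ-≤ m t<n ⟩
  m * n     ∎
  where open ≤-Reasoning

-- From (a + c)(a n + t + 1) = ((a + c) t + c) + a ((a + c) n + 1).
mod-on-block : ∀ a c n t → t < n →
  ((a + c) * suc (a * n + t)) % suc ((a + c) * n) ≡ (a + c) * t + c
mod-on-block a c n t t<n = begin
  ((a + c) * suc (a * n + t)) % suc ((a + c) * n)               ≡⟨ cong (_% suc ((a + c) * n)) (expand a c n t) ⟩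
  ((a + c) * t + c + a * suc ((a + c) * n)) % suc ((a + c) * n) ≡⟨ [m+kn]%n≡m%n ((a + c) * t + c) a _ ⟩
  ((a + c) * t + c) % suc ((a + c) * n)                         ≡⟨ m<n⇒m%n≡m (s≤s (m*t+c≤m*n (a + c) (m≤n+m c a) t<n)) ⟩
  (a + c) * t + c                                               ∎
  where
    open ≡-Reasoning
    expand : ∀ a c n t → (a + c) * suc (a * n + t) ≡ (a + c) * t + c + a * suc ((a + c) * n)
    expand = solve-∀

σ-on-block : ∀ {k n a t} → a < k → t < n → σ k n (suc (a * n + t)) ≡ k * t + (k ∸ a)
σ-on-block {k} {n} {a} {t} a<k t<n =
  subst (λ m → (m * suc (a * n + t)) % suc (m * n) ≡ m * t + (k ∸ a))
        (m+[n∸m]≡n (<⇒≤ a<k)) (mod-on-block a (k ∸ a) n t t<n)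

<ᵇ-true : ∀ {m n} → m < n → (m <ᵇ n) ≡ true
<ᵇ-true m<n = Equivalence.to T-≡ (<⇒<ᵇ m<n)

<ᵇ-false : ∀ {m n} → m ≮ n → (m <ᵇ n) ≡ false
<ᵇ-false {m} {n} m≮n with m <ᵇ n in eq
... | false = refl
... | true  = contradiction (<ᵇ⇒< m n (subst T (sym eq) _)) m≮n

earlier-block-< : ∀ {n a b t u} → a < b → t < n → a * n + t < b * n + u
earlier-block-< {n} {a} {b} {t} {u} a<b t<n = begin-strict
  a * n + t   <⟨ +-monoʳ-< (a * n) t<n ⟩
  a * n + n   ≡⟨ +-comm (a * n) n ⟩
  suc a * n   ≤⟨ *-monoˡ-≤ n a<b ⟩
  b * n       ≤⟨ m≤m+n (b * n) u ⟩
  b * n + u   ∎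
  where open ≤-Reasoning

-- Positions compare lexicographically in (block, offset), values in (offset, reversed block).
isInversion-on-blocks : ∀ {k n a b t u} → b < k → t < n → u < n →
  ((a * n + t) <ᵇ (b * n + u)) ∧ ((k * u + (k ∸ b)) <ᵇ (k * t + (k ∸ a))) ≡ (a <ᵇ b) ∧ not (t <ᵇ u)
isInversion-on-blocks {k} {n} {a} {b} {t} {u} b<k t<n u<n with <-cmp a b
... | tri> _ _ b<a rewrite <ᵇ-false (<⇒≯ (earlier-block-< {u = t} b<a u<n)) | <ᵇ-false (<⇒≯ b<a) = refl
... | tri≈ _ refl _ rewrite <ᵇ-false (<-irrefl {a} refl) with <-cmp t u
...   | tri< t<u _ _ rewrite <ᵇ-true (+-monoʳ-< (a * n) t<u)
                           | <ᵇ-false (≤⇒≯ (+-monoˡ-≤ (k ∸ a) (*-monoʳ-≤ k (<⇒≤ t<u)))) = refl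
...   | tri≈ _ refl _ rewrite <ᵇ-false (<-irrefl {a * n + t} refl) = refl
...   | tri> _ _ u<t rewrite <ᵇ-false (<⇒≯ (+-monoʳ-< (a * n) u<t)) = refl
isInversion-on-blocks {k} {n} {a} {b} {t} {u} b<k t<n u<n
    | tri< a<b _ _ rewrite <ᵇ-true (earlier-block-< {u = u} a<b t<n) | <ᵇ-true a<b with <-cmp t u
... | tri< t<u _ _ rewrite <ᵇ-true t<u =
  <ᵇ-false (≤⇒≯ (≤-trans (m*t+c≤m*n k (m∸n≤m k a) t<u) (m≤m+n (k * u) (k ∸ b))))
... | tri≈ _ refl _ rewrite <ᵇ-false (<-irrefl {t} refl) =
  <ᵇ-true (+-monoʳ-< (k * t) (∸-monoʳ-< a<b (<⇒≤ b<k)))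
... | tri> _ _ u<t rewrite <ᵇ-false (<⇒≯ u<t) =
  <ᵇ-true (+-mono-≤-< (*-monoʳ-≤ k (<⇒≤ u<t)) (∸-monoʳ-< a<b (<⇒≤ b<k)))

triangle : ℕ → ℕ
triangle m = ∑[ i < m ] i

triangle-suc : ∀ m → triangle (suc m) ≡ m + triangle m
triangle-suc m = begin
  ∑[ i < m ] (1 + i)        ≡⟨ ∑-distrib-+ m (λ _ → 1) (λ i → i) ⟩
  ∑[ i < m ] 1 + triangle m ≡⟨ cong (_+ triangle m) (trans (∑-const m 1) (*-identityʳ m)) ⟩
  m + triangle m            ∎
  where open ≡-Reasoning

∑-∸-triangle : ∀ n → ∑[ u < n ] (n ∸ u) ≡ triangle (suc n)
∑-∸-triangle zero    = refl
∑-∸-triangle (suc n) = begin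
  suc n + ∑[ u < n ] (n ∸ u) ≡⟨ cong (_+_ (suc n)) (∑-∸-triangle n) ⟩
  suc n + triangle (suc n)   ≡⟨ triangle-suc (suc n) ⟨
  triangle (suc (suc n))     ∎
  where open ≡-Reasoning

triangle-*2 : ∀ m → triangle m * 2 ≡ (m ∸ 1) * m
triangle-*2 zero          = refl
triangle-*2 (suc zero)    = refl
triangle-*2 (suc (suc m)) = begin
  triangle (2 + m) * 2             ≡⟨ cong (_* 2) (triangle-suc (suc m)) ⟩
  (suc m + triangle (suc m)) * 2   ≡⟨ *-distribʳ-+ 2 (suc m) _ ⟩
  suc m * 2 + triangle (suc m) * 2 ≡⟨ cong (_+_ (suc m * 2)) (triangle-*2 (suc m)) ⟩
  suc m * 2 + m * suc m            ≡⟨ rearrange m ⟩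
  suc m * suc (suc m)              ∎
  where
    open ≡-Reasoning
    rearrange : ∀ m → suc m * 2 + m * suc m ≡ suc m * suc (suc m)
    rearrange = solve-∀

triangle≡ : ∀ m → triangle m ≡ (m ∸ 1) * m / 2
triangle≡ m = trans (sym (m*n/n≡m (triangle m) 2)) (cong (_/ 2) (triangle-*2 m))

triangle-+4 : ∀ m → triangle (4 + m) ≡ (2 * m + 3) + ((2 * m + 3) + triangle m)
triangle-+4 m = begin
  triangle (4 + m)                                    ≡⟨ triangle-suc (3 + m) ⟩
  3 + m + triangle (3 + m)                            ≡⟨ cong (_+_ (3 + m)) (triangle-suc (2 + m)) ⟩
  3 + m + (2 + m + triangle (2 + m))                  ≡⟨ cong (λ x → 3 + m + (2 + m + x)) (triangle-suc (1 + m)) ⟩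
  3 + m + (2 + m + (1 + m + triangle (1 + m)))        ≡⟨ cong (λ x → 3 + m + (2 + m + (1 + m + x))) (triangle-suc m) ⟩
  3 + m + (2 + m + (1 + m + (m + triangle m)))        ≡⟨ regroup m (triangle m) ⟩
  (2 * m + 3) + ((2 * m + 3) + triangle m)            ∎
  where
    open ≡-Reasoning
    regroup : ∀ m x → 3 + m + (2 + m + (1 + m + (m + x))) ≡ (2 * m + 3) + ((2 * m + 3) + x)
    regroup = solve-∀

isEven : ℕ → Bool
isEven zero          = true
isEven (suc zero)    = false
isEven (suc (suc m)) = isEven m

signOfParity : Bool → ℤ
signOfParity even = if even then + 1 else - (+ 1)

signOf≡ : ∀ m → signOf m ≡ signOfParity (isEven m)
signOf≡ m = cong signOfParity (%2≡ᵇ0 m)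
  where
    %2≡ᵇ0 : ∀ m → ((m % 2) ≡ᵇ 0) ≡ isEven m
    %2≡ᵇ0 zero          = refl
    %2≡ᵇ0 (suc zero)    = refl
    %2≡ᵇ0 (suc (suc m)) = %2≡ᵇ0 m

isEven-double-+ : ∀ m n → isEven (m + (m + n)) ≡ isEven n
isEven-double-+ zero    n = refl
isEven-double-+ (suc m) n rewrite +-suc m (m + n) = isEven-double-+ m n

isEven-* : ∀ m n → isEven (m * n) ≡ isEven m ∨ isEven n
isEven-* zero          n = refl
isEven-* (suc zero)    n = cong isEven (+-identityʳ n)
isEven-* (suc (suc m)) n = trans (isEven-double-+ n (m * n)) (isEven-* m n)

isEven-triangle-4*+ : ∀ q m → isEven (triangle (4 * q + m)) ≡ isEven (triangle m)
isEven-triangle-4*+ zero    m = refl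
isEven-triangle-4*+ (suc q) m = begin
  isEven (triangle (4 * suc q + m))   ≡⟨ cong (isEven ∘ triangle) (shift q m) ⟩
  isEven (triangle (4 + (4 * q + m))) ≡⟨ cong isEven (triangle-+4 (4 * q + m)) ⟩
  isEven (2 * (4 * q + m) + 3 + (2 * (4 * q + m) + 3 + triangle (4 * q + m)))
                                      ≡⟨ isEven-double-+ (2 * (4 * q + m) + 3) _ ⟩
  isEven (triangle (4 * q + m))       ≡⟨ isEven-triangle-4*+ q m ⟩
  isEven (triangle m)                 ∎
  where
    open ≡-Reasoning
    shift : ∀ q m → 4 * suc q + m ≡ 4 + (4 * q + m)
    shift = solve-∀

isEven-triangle-suc-4*+ : ∀ q r → isEven (triangle (suc (4 * q + r))) ≡ isEven (triangle (suc r))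
isEven-triangle-suc-4*+ q r =
  trans (cong (isEven ∘ triangle) (sym (+-suc (4 * q) r))) (isEven-triangle-4*+ q (suc r))

isEven-triangle-mod4 : ∀ m → isEven (triangle m) ≡ isEven (triangle (m % 4))
isEven-triangle-mod4 0 = refl
isEven-triangle-mod4 1 = refl
isEven-triangle-mod4 2 = refl
isEven-triangle-mod4 3 = refl
isEven-triangle-mod4 (suc (suc (suc (suc m)))) = trans (isEven-triangle-4*+ 1 m) (isEven-triangle-mod4 m)

isEven-triangle-odd : ∀ k → k % 4 ≡ 2 ⊎ k % 4 ≡ 3 → isEven (triangle k) ≡ false
isEven-triangle-odd k (inj₁ k%4≡2) = trans (isEven-triangle-mod4 k) (cong (isEven ∘ triangle) k%4≡2)
isEven-triangle-odd k (inj₂ k%4≡3) = trans (isEven-triangle-mod4 k) (cong (isEven ∘ triangle) k%4≡3)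

isEven-triangle-even : ∀ k → k % 4 ≡ 0 ⊎ k % 4 ≡ 1 → isEven (triangle k) ≡ true
isEven-triangle-even k (inj₁ k%4≡0) = trans (isEven-triangle-mod4 k) (cong (isEven ∘ triangle) k%4≡0)
isEven-triangle-even k (inj₂ k%4≡1) = trans (isEven-triangle-mod4 k) (cong (isEven ∘ triangle) k%4≡1)

invσ≡triangle*triangle : ∀ k n → invσ k n ≡ triangle k * triangle (suc n)
invσ≡triangle*triangle k n = begin
  invσ k n
    ≡⟨ inversions≡∑ (k * n) (σ k n) ⟩
  ∑[ j < k * n ] ∑[ i < k * n ] inverted i j
    ≡⟨ ∑-blocks k n _ ⟩
  ∑[ b < k ] ∑[ u < n ] ∑[ i < k * n ] inverted i (b * n + u)
    ≡⟨ ∑-cong k (λ b _ → ∑-cong n (λ u _ → ∑-blocks k n _)) ⟩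
  ∑[ b < k ] ∑[ u < n ] ∑[ a < k ] ∑[ t < n ] inverted (a * n + t) (b * n + u)
    ≡⟨ ∑-cong k (λ b b<k → ∑-cong n (λ u u<n → inversionsBefore b<k u<n)) ⟩
  ∑[ b < k ] ∑[ u < n ] (b * (n ∸ u))
    ≡⟨ ∑-product k n (λ b → b) (n ∸_) ⟩
  triangle k * ∑[ u < n ] (n ∸ u)
    ≡⟨ cong (triangle k *_) (∑-∸-triangle n) ⟩
  triangle k * triangle (suc n) ∎
  where
    open ≡-Reasoning
    inverted : ℕ → ℕ → ℕ
    inverted i j = indicator ((i <ᵇ j) ∧ (σ k n (suc j) <ᵇ σ k n (suc i)))

    inversionsBefore : ∀ {b u} → b < k → u < n →
      ∑[ a < k ] ∑[ t < n ] inverted (a * n + t) (b * n + u) ≡ b * (n ∸ u)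
    inversionsBefore {b} {u} b<k u<n = begin
      ∑[ a < k ] ∑[ t < n ] inverted (a * n + t) (b * n + u)
        ≡⟨ ∑-cong k (λ a a<k → ∑-cong n (λ t t<n → onBlocks a<k t<n)) ⟩
      ∑[ a < k ] ∑[ t < n ] (indicator (a <ᵇ b) * indicator (not (t <ᵇ u)))
        ≡⟨ ∑-product k n _ _ ⟩
      ∑[ a < k ] indicator (a <ᵇ b) * ∑[ t < n ] indicator (not (t <ᵇ u))
        ≡⟨ cong₂ _*_ (∑-indicator-< k b (<⇒≤ b<k)) (∑-indicator-≥ n u) ⟩
      b * (n ∸ u) ∎
      where
        onBlocks : ∀ {a t} → a < k → t < n →
          inverted (a * n + t) (b * n + u) ≡ indicator (a <ᵇ b) * indicator (not (t <ᵇ u))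
        onBlocks {a} {t} a<k t<n
          rewrite σ-on-block b<k u<n | σ-on-block a<k t<n | isInversion-on-blocks {k} {n} {a} b<k t<n u<n =
          indicator-∧ (a <ᵇ b) (not (t <ᵇ u))

invσ≡ : ∀ k n → invσ k n ≡ ((k ∸ 1) * k / 2) * (n * (n + 1) / 2)
invσ≡ k n = trans (invσ≡triangle*triangle k n)
  (cong₂ _*_ (triangle≡ k) (trans (triangle≡ (suc n)) (cong (λ x → n * x / 2) (+-comm 1 n))))

signσ≡ : ∀ k n → signσ k n ≡ signOfParity (isEven (triangle k) ∨ isEven (triangle (suc n)))
signσ≡ k n = begin
  signOf (invσ k n)                                 ≡⟨ cong signOf (invσ≡triangle*triangle k n) ⟩
  signOf (triangle k * triangle (suc n))            ≡⟨ signOf≡ (triangle k * triangle (suc n)) ⟩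
  signOfParity (isEven (triangle k * triangle (suc n)))
                                                    ≡⟨ cong signOfParity (isEven-* (triangle k) (triangle (suc n))) ⟩
  signOfParity (isEven (triangle k) ∨ isEven (triangle (suc n))) ∎
  where open ≡-Reasoning

signσ-triangle-odd : ∀ k n → isEven (triangle k) ≡ false → signσ k n ≡ signOfParity (isEven (triangle (suc n)))
signσ-triangle-odd k n odd = trans (signσ≡ k n) (cong (λ b → signOfParity (b ∨ isEven (triangle (suc n)))) odd)

signσ-triangle-even : ∀ k n → isEven (triangle k) ≡ true → signσ k n ≡ + 1
signσ-triangle-even k n even = trans (signσ≡ k n) (cong (λ b → signOfParity (b ∨ isEven (triangle (suc n)))) even)

proposition2p8 : (k : ℕ) → 2 ≤ k →
    ((n : ℕ) → 1 ≤ n → invσ k n ≡ (((k ∸ 1) * k) / 2) * ((n * (n + 1)) / 2))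
    × ((k % 4 ≡ 2 ⊎ k % 4 ≡ 3) →
    (m : ℕ) →
    (signσ k (4 * m + 1) ≡ - (+ 1)) × (signσ k (4 * m + 2) ≡ - (+ 1))
    × (signσ k (4 * m + 3) ≡ + 1) × (signσ k (4 * m + 4) ≡ + 1))
    × ((k % 4 ≡ 0 ⊎ k % 4 ≡ 1) → (n : ℕ) → 1 ≤ n → signσ k n ≡ + 1)
proposition2p8 k _ = (λ n _ → invσ≡ k n) , periodic , constant
  where
    periodic : k % 4 ≡ 2 ⊎ k % 4 ≡ 3 → ∀ m →
      (signσ k (4 * m + 1) ≡ - (+ 1)) × (signσ k (4 * m + 2) ≡ - (+ 1))
      × (signσ k (4 * m + 3) ≡ + 1) × (signσ k (4 * m + 4) ≡ + 1)
    periodic k%4 m = signAt 1 , signAt 2 , signAt 3 , signAt 4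
      where
        signAt : ∀ r → signσ k (4 * m + r) ≡ signOfParity (isEven (triangle (suc r)))
        signAt r = trans (signσ-triangle-odd k (4 * m + r) (isEven-triangle-odd k k%4))
                         (cong signOfParity (isEven-triangle-suc-4*+ m r))

    constant : k % 4 ≡ 0 ⊎ k % 4 ≡ 1 → ∀ n → 1 ≤ n → signσ k n ≡ + 1
    constant k%4 n _ = signσ-triangle-even k n (isEven-triangle-even k k%4)
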